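{- Let $n_1,\ldots,n_r,r,s$ be positive integers with $3\leq n_1\leq\cdots\leq n_r$ and $r>s$. If $\left\lfloor\frac{rn_1-r}{s}\right\rfloor\leq\binom{r}{s}$, then $$\left\lfloor\frac{rn_1-r}{s}\right\rfloor+1\leq \mathrm{R}_{r,s}(K_{1,n_1},\ldots,K_{1,n_r})\leq \left\lceil\frac{\sum_{i=1}^{r}n_i-r+1}{s}\right\rceil+1.$$ Moreover, the upper bound is sharp.
   Context: $K_{1,n}$ denotes the star with one center and $n$ leaves. For positive integers $r\ge s$ and graphs $G_1,\dots,G_r$, the set-coloring Ramsey number $\mathrm{R}_{r,s}(G_1,\dots,G_r)$ is the least $N\in\mathbb{N}$ such that for every coloring $\chi:E(K_N)\to\binom{[r]}{s}$ (each edge receives a set of $s$ distinct colors from $[r]$) there exist $i\in[r]$ and a copy of $G_i$ in $K_N$ with $i\in\chi(e)$ for every edge $e$ of this copy. -}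

module Defs where

open import Data.Nat using (ℕ; zero; suc; _+_; _*_; _∸_; _≤_; _<_; NonZero; s≤s; z≤n)
open import Data.Nat.DivMod using (_/_)
open import Data.Fin using (Fin; fromℕ<) renaming (zero to fzero; suc to fsuc)
open import Data.Fin.Subset using (Subset; _∈_; ∣_∣)
open import Data.Vec using (tabulate)
open import Data.Vec using (sum)
open import Data.Product using (Σ; _×_; ∃)
open import Relation.Binary.PropositionalEquality using (_≡_; _≢_)
open import Relation.Nullary using (¬_)
open import Function.Definitions using (Injective)
open import Data.Nat.Combinatorics using (_C_)

record Graph : Set₁ where
  field
    V : ℕ
    E : Fin V → Fin V → Set
open Graph public

data StarEdge (n : ℕ) : Fin (suc n) → Fin (suc n) → Set where
  out : (j : Fin n) → StarEdge n fzero (fsuc j)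
  inn : (j : Fin n) → StarEdge n (fsuc j) fzero

K1 : ℕ → Graph
K1 n = record { V = suc n ; E = StarEdge n }

-- An (r,s)-set-colouring of the edges of K_N: every edge {u,v} (u ≢ v)
-- receives a set of exactly s colours from [r] = Fin r.  The value on
-- the diagonal is irrelevant.
record SetColouring (N r s : ℕ) : Set where
  field
    χ        : Fin N → Fin N → Subset r
    symmetric : ∀ u v → u ≢ v → χ u v ≡ χ v u
    size      : ∀ u v → u ≢ v → ∣ χ u v ∣ ≡ s
open SetColouring public

MonoCopy : ∀ {N r s} → SetColouring N r s → Fin r → Graph → Set
MonoCopy {N} c i G =
  Σ (Fin (V G) → Fin N) λ φ →
    Injective _≡_ _≡_ φ × (∀ a b → E G a b → i ∈ χ c (φ a) (φ b))

RamseyProp : (r s : ℕ) → (Fin r → Graph) → ℕ → Set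
RamseyProp r s G N = (c : SetColouring N r s) → ∃ λ i → MonoCopy c i (G i)

IsSetColouringRamsey : (r s : ℕ) → (Fin r → Graph) → ℕ → Set
IsSetColouringRamsey r s G N = RamseyProp r s G N × (∀ M → M < N → ¬ RamseyProp r s G M)

⌈_/_⌉ : (a s : ℕ) → .{{NonZero s}} → ℕ
⌈ a / s ⌉ = (a + (s ∸ 1)) / s

Σn : ∀ {r} → (Fin r → ℕ) → ℕ
Σn n = sum (tabulate n)

Hyp : (r s : ℕ) → (n : Fin r → ℕ) → (0<r : 0 < r) → .{{NonZero s}} → Set
Hyp r s n 0<r =
  1 ≤ s × s < r × 3 ≤ n (fromℕ< 0<r) × (∀ i j → Data.Fin._≤_ i j → n i ≤ n j)

lowerExpr : (r s : ℕ) → (n : Fin r → ℕ) → (0<r : 0 < r) → .{{NonZero s}} → ℕ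
lowerExpr r s n 0<r = (r * n (fromℕ< 0<r) ∸ r) / s

upperExpr : (r s : ℕ) → (n : Fin r → ℕ) → .{{NonZero s}} → ℕ
upperExpr r s n = ⌈ Σn n ∸ r + 1 / s ⌉

FullHyp : (r s : ℕ) → (n : Fin r → ℕ) → (0<r : 0 < r) → .{{NonZero s}} → Set
FullHyp r s n 0<r = Hyp r s n 0<r × lowerExpr r s n 0<r ≤ r C s

-- For a colouring of K_N, the i-degree of a vertex v is the number of edges vu whose
-- colour set contains i; there is a K_{1,nᵢ} in colour i iff some i-degree reaches nᵢ.
--
-- Upper bound: in K_{U+1} the colour degrees of a vertex add up to U s, since each of its
-- U edges carries s colours; once U s ≥ Σ nᵢ − r + 1 they cannot all be below nᵢ.
--
-- Lower bound: on the vertex set ℤ_M give the edge uv the s consecutive colours (mod r)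
-- starting at (u + v) s.  The edges at a vertex get distinct positions u + v, so its colour
-- incidences occupy distinct slots among the first M s ≤ r (n₁ − 1) numbers, and a colour i
-- only owns the n₁ − 1 slots ≡ i (mod r) there.
--
-- The Ramsey property of N is decidable (there are finitely many colourings of K_N), so
-- the least N with it exists and lies between the two bounds.  For r = 3, s = 2, nᵢ = 3
-- the bounds are 4 and 5, and a colouring of K₄ rules out 4.

module Submission where

open import Defs
open import Data.Nat using (ℕ; _+_; _≤_; _<_; NonZero)
open import Data.Fin using (Fin)
open import Data.Product using (Σ; _×_; ∃)
open import Relation.Binary.PropositionalEquality using (_≡_)

open import Level using (0ℓ)
open import Function using (_∘_; _$_)
open import Function.Definitions using (Injective)
open import Function.Bundles using (Equivalence)
open import Data.Bool using (Bool; true; false)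
import Data.Bool.Properties as Bool
open import Data.Nat using (zero; suc; _*_; _∸_; _<ᵇ_; s≤s; z≤n; z<s; _≤?_; _<?_)
open import Data.Nat.Properties
open import Data.Nat.DivMod
open import Data.Nat.Divisibility using (divides-refl)
open import Data.Nat.Induction using (<-rec)
open import Data.Nat.Tactic.RingSolver using (solve-∀)
open import Algebra.Properties.CommutativeMonoid.Sum +-0-commutativeMonoid
  using (sum-syntax; ∑-comm; sum-remove; sum-init-last; sum-cong-≗; sum-replicate-zero)
open import Data.Fin using (zero; suc; toℕ; fromℕ<; inject≤; inject₁; fromℕ; punchIn)
import Data.Fin.Properties as Fin
open import Data.Fin.Patterns using (0F; 1F; 2F; 3F)
open import Data.Fin.Subset using (Subset; _∈_; ∣_∣; ∁; ⁅_⁆)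
open import Data.Fin.Subset.Properties using (anySubset?; ∣∁p∣≡n∸∣p∣; ∣⁅x⁆∣≡1)
open import Data.Vec using (Vec; []; _∷_; lookup; tabulate)
open import Data.Vec.Properties using (lookup∘tabulate; tabulate∘lookup; lookup⇒[]=; []=⇒lookup; ≡-dec)
open import Data.Product using (_,_; proj₁; proj₂)
open import Data.Unit using (tt)
open import Relation.Binary.PropositionalEquality
  using (_≢_; _≗_; refl; sym; trans; cong; cong₂; subst; module ≡-Reasoning)
open import Relation.Nullary using (¬_; Dec; yes; no; ¬?; contradiction)
open import Relation.Nullary.Decidable using (_×-dec_; _→-dec_; map′; toWitness)
open import Relation.Unary using (Pred; Decidable)

bit : Bool → ℕ
bit false = 0
bit true  = 1

count : ∀ {k} → (Fin k → Bool) → ℕ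
count {k} f = ∑[ x < k ] bit (f x)

count-cong : ∀ {k} {f g : Fin k → Bool} → f ≗ g → count f ≡ count g
count-cong f≗g = sum-cong-≗ (cong bit ∘ f≗g)

∣tabulate∣≡count : ∀ {k} (f : Fin k → Bool) → ∣ tabulate f ∣ ≡ count f
∣tabulate∣≡count {zero}  f = refl
∣tabulate∣≡count {suc k} f with f zero
... | true  = cong suc (∣tabulate∣≡count (f ∘ suc))
... | false = ∣tabulate∣≡count (f ∘ suc)

∣p∣≡count-lookup : ∀ {k} (p : Subset k) → ∣ p ∣ ≡ count (lookup p)
∣p∣≡count-lookup p = trans (cong ∣_∣ (sym (tabulate∘lookup p))) (∣tabulate∣≡count (lookup p))

count-<ᵇ : ∀ k s → s ≤ k → count {k} (λ c → toℕ c <ᵇ s) ≡ s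
count-<ᵇ zero    zero    _         = refl
count-<ᵇ (suc k) zero    _         = sum-replicate-zero (suc k)
count-<ᵇ (suc k) (suc s) (s≤s s≤k) = cong suc (count-<ᵇ k s s≤k)

count-rotate : ∀ r .{{_ : NonZero r}} (g : ℕ → Bool) b →
  count {r} (λ c → g ((toℕ c + b) % r)) ≡ count {r} (g ∘ toℕ)
count-rotate r g zero = count-cong λ c →
  cong g (trans (cong (_% r) (+-identityʳ (toℕ c))) (m<n⇒m%n≡m (Fin.toℕ<n c)))
count-rotate r@(suc r′) g (suc b) = trans rotate-once (count-rotate r g b)
  where
  h : Fin r → ℕ
  h c = bit (g ((toℕ c + b) % r))
  rotate-once : count {r} (λ c → g ((toℕ c + suc b) % r)) ≡ count {r} (λ c → g ((toℕ c + b) % r))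
  rotate-once = begin
    count {r} (λ c → g ((toℕ c + suc b) % r))
      ≡⟨ sum-init-last {r′} (λ c → bit (g ((toℕ c + suc b) % r))) ⟩
    ∑[ c < r′ ] bit (g ((toℕ (inject₁ c) + suc b) % r)) + bit (g ((toℕ (fromℕ r′) + suc b) % r))
      ≡⟨ cong₂ _+_ (sum-cong-≗ {r′} λ c → cong (λ x → bit (g (x % r))) (inject₁-step c))
                   (cong (λ x → bit (g x)) last-step) ⟩
    ∑[ c < r′ ] h (suc c) + h zero
      ≡⟨ +-comm _ (h zero) ⟩
    count {r} (λ c → g ((toℕ c + b) % r)) ∎
    where
    open ≡-Reasoning
    inject₁-step : ∀ c → toℕ (inject₁ c) + suc b ≡ suc (toℕ c) + b
    inject₁-step c = trans (cong (_+ suc b) (Fin.toℕ-inject₁ c)) (+-suc (toℕ c) b)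
    last-step : (toℕ (fromℕ r′) + suc b) % r ≡ b % r
    last-step = begin
      (toℕ (fromℕ r′) + suc b) % r ≡⟨ cong (λ x → (x + suc b) % r) (Fin.toℕ-fromℕ r′) ⟩
      (r′ + suc b) % r             ≡⟨ cong (_% r) (trans (+-suc r′ b) (+-comm r b)) ⟩
      (b + r) % r                  ≡⟨ [m+n]%n≡m%n b r ⟩
      b % r                        ∎

enum : ∀ {k} (f : Fin k → Bool) → Fin (count f) → Fin k
enum {suc k} f j with f zero
... | false = suc (enum (f ∘ suc) j)
... | true with j
...   | zero   = zero
...   | suc j′ = suc (enum (f ∘ suc) j′)

enum-true : ∀ {k} (f : Fin k → Bool) j → f (enum f j) ≡ true
enum-true {suc k} f j with f zero in f₀
... | false = enum-true (f ∘ suc) j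
... | true with j
...   | zero   = f₀
...   | suc j′ = enum-true (f ∘ suc) j′

enum-injective : ∀ {k} (f : Fin k → Bool) → Injective _≡_ _≡_ (enum f)
enum-injective {suc k} f {a} {b} e with f zero
... | false = enum-injective (f ∘ suc) (Fin.suc-injective e)
... | true with a | b | e
...   | zero   | zero   | _ = refl
...   | suc a′ | suc b′ | e′ = cong suc (enum-injective (f ∘ suc) (Fin.suc-injective e′))

enum-surjective : ∀ {k} (f : Fin k → Bool) x → f x ≡ true → ∃ λ j → enum f j ≡ x
enum-surjective {suc k} f x fx with f zero in f₀ | x
... | true  | zero  = zero , refl
... | false | zero  = contradiction (trans (sym fx) f₀) λ ()
... | true  | suc y = let j , e = enum-surjective (f ∘ suc) y fx in suc j , cong suc e
... | false | suc y = let j , e = enum-surjective (f ∘ suc) y fx in j , cong suc e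

≤count⇒injection : ∀ {k n} (f : Fin k → Bool) → n ≤ count f →
  Σ (Fin n → Fin k) λ ψ → Injective _≡_ _≡_ ψ × (∀ j → f (ψ j) ≡ true)
≤count⇒injection f n≤ =
  enum f ∘ (λ j → inject≤ j n≤) ,
  Fin.inject≤-injective n≤ n≤ _ _ ∘ enum-injective f ,
  λ j → enum-true f (inject≤ j n≤)

count≤ : ∀ {k m} (f : Fin k → Bool) (g : ∀ x → f x ≡ true → Fin m) →
  (∀ {x y} fx fy → g x fx ≡ g y fy → x ≡ y) → count f ≤ m
count≤ f g g-injective =
  Fin.injective⇒≤ {f = λ j → g (enum f j) (enum-true f j)} (enum-injective f ∘ g-injective _ _)

injection⇒≤count : ∀ {k n} (f : Fin k → Bool) (ψ : Fin n → Fin k) →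
  Injective _≡_ _≡_ ψ → (∀ j → f (ψ j) ≡ true) → n ≤ count f
injection⇒≤count f ψ ψ-injective ψ-true =
  Fin.injective⇒≤ {f = proj₁ ∘ preimage} λ {a} {b} e →
    ψ-injective (trans (sym (proj₂ (preimage a))) (trans (cong (enum f) e) (proj₂ (preimage b))))
  where
  preimage : ∀ j → ∃ λ i → enum f i ≡ ψ j
  preimage j = enum-surjective f (ψ j) (ψ-true j)

∑-const : ∀ k a → ∑[ _ < k ] a ≡ k * a
∑-const zero    a = refl
∑-const (suc k) a = cong (a +_) (∑-const k a)

∑-mono-< : ∀ {k} (f g : Fin k → ℕ) → (∀ x → f x < g x) → k + ∑[ x < k ] f x ≤ ∑[ x < k ] g x
∑-mono-< {zero}  f g f<g = z≤n
∑-mono-< {suc k} f g f<g = begin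
  suc k + (f zero + ∑[ x < k ] f (suc x))   ≡⟨ cong suc (x+[y+z]≡y+[x+z] k (f zero) _) ⟩
  suc (f zero) + (k + ∑[ x < k ] f (suc x)) ≤⟨ +-mono-≤ (f<g zero) (∑-mono-< (f ∘ suc) (g ∘ suc) (f<g ∘ suc)) ⟩
  g zero + ∑[ x < k ] g (suc x)             ∎
  where
  open ≤-Reasoning
  x+[y+z]≡y+[x+z] : ∀ x y z → x + (y + z) ≡ y + (x + z)
  x+[y+z]≡y+[x+z] = solve-∀

Σn≡∑ : ∀ {r} (n : Fin r → ℕ) → Σn n ≡ ∑[ i < r ] n i
Σn≡∑ {zero}  n = refl
Σn≡∑ {suc r} n = cong (n zero +_) (Σn≡∑ (n ∘ suc))

m≤⌈m/n⌉*n : ∀ m n .{{_ : NonZero n}} → m ≤ ⌈ m / n ⌉ * n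
m≤⌈m/n⌉*n m n = +-cancelʳ-≤ (n ∸ 1) m _ $ begin
  m + (n ∸ 1)                                  ≡⟨ m≡m%n+[m/n]*n (m + (n ∸ 1)) n ⟩
  (m + (n ∸ 1)) % n + ⌈ m / n ⌉ * n            ≤⟨ +-monoˡ-≤ _ (m<n⇒m≤n∸1 (m%n<n (m + (n ∸ 1)) n)) ⟩
  (n ∸ 1) + ⌈ m / n ⌉ * n                      ≡⟨ +-comm (n ∸ 1) _ ⟩
  ⌈ m / n ⌉ * n + (n ∸ 1)                      ∎
  where
  open ≤-Reasoning
  m<n⇒m≤n∸1 : ∀ {m n} → m < n → m ≤ n ∸ 1
  m<n⇒m≤n∸1 {n = suc n} (s≤s m≤n) = m≤n

[m%n+k]%n≡[m+k]%n : ∀ m k n .{{_ : NonZero n}} → (m % n + k) % n ≡ (m + k) % n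
[m%n+k]%n≡[m+k]%n m k n = begin
  (m % n + k) % n             ≡⟨ %-distribˡ-+ (m % n) k n ⟩
  (m % n % n + k % n) % n     ≡⟨ cong (λ x → (x + k % n) % n) (m%n%n≡m%n m n) ⟩
  (m % n + k % n) % n         ≡⟨ %-distribˡ-+ m k n ⟨
  (m + k) % n                 ∎
  where open ≡-Reasoning

-- Colour degrees and monochromatic stars

stars : ∀ {r} → (Fin r → ℕ) → Fin r → Graph
stars n i = K1 (n i)

neighbour? : ∀ {N r} → (Fin N → Fin N → Subset r) → Fin N → Fin r → Fin N → Bool
neighbour? χ v i u with u Fin.≟ v
... | yes _ = false
... | no  _ = lookup (χ v u) i

degree : ∀ {N r} → (Fin N → Fin N → Subset r) → Fin N → Fin r → ℕ
degree χ v i = count (neighbour? χ v i)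

neighbour?-self : ∀ {N r} (χ : Fin N → Fin N → Subset r) v i → neighbour? χ v i v ≡ false
neighbour?-self χ v i with v Fin.≟ v
... | yes _   = refl
... | no  v≢v = contradiction refl v≢v

neighbour?-≢ : ∀ {N r} (χ : Fin N → Fin N → Subset r) {v u} i → u ≢ v →
  neighbour? χ v i u ≡ lookup (χ v u) i
neighbour?-≢ χ {v} {u} i u≢v with u Fin.≟ v
... | yes u≡v = contradiction u≡v u≢v
... | no  _   = refl

neighbour?-true : ∀ {N r} (χ : Fin N → Fin N → Subset r) {v u} i → neighbour? χ v i u ≡ true →
  u ≢ v × lookup (χ v u) i ≡ true
neighbour?-true χ {v} {u} i nb with u Fin.≟ v
... | no u≢v = u≢v , nb

degree-cong : ∀ {N r} {χ χ′ : Fin N → Fin N → Subset r} → (∀ u v → χ u v ≡ χ′ u v) →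
  ∀ v i → degree χ v i ≡ degree χ′ v i
degree-cong {χ = χ} {χ′} χ≡χ′ v i = count-cong λ u → neighbour?-cong u
  where
  neighbour?-cong : ∀ u → neighbour? χ v i u ≡ neighbour? χ′ v i u
  neighbour?-cong u with u Fin.≟ v
  ... | yes _ = refl
  ... | no  _ = cong (λ p → lookup p i) (χ≡χ′ v u)

neighbours⇒star : ∀ {N r s} (c : SetColouring N r s) v i {n} (ψ : Fin n → Fin N) →
  Injective _≡_ _≡_ ψ → (∀ j → neighbour? (χ c) v i (ψ j) ≡ true) → MonoCopy c i (K1 n)
neighbours⇒star c v i {n} ψ ψ-injective ψ-neighbour = φ , φ-injective , φ-edge
  where
  ψ≢v : ∀ j → ψ j ≢ v
  ψ≢v j = proj₁ (neighbour?-true (χ c) i (ψ-neighbour j))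
  i∈χvψ : ∀ j → lookup (χ c v (ψ j)) i ≡ true
  i∈χvψ j = proj₂ (neighbour?-true (χ c) i (ψ-neighbour j))
  φ : Fin (suc n) → Fin _
  φ zero    = v
  φ (suc j) = ψ j
  φ-injective : Injective _≡_ _≡_ φ
  φ-injective {zero}  {zero}  _ = refl
  φ-injective {zero}  {suc b} e = contradiction (sym e) (ψ≢v b)
  φ-injective {suc a} {zero}  e = contradiction e (ψ≢v a)
  φ-injective {suc a} {suc b} e = cong suc (ψ-injective e)
  φ-edge : ∀ a b → StarEdge n a b → i ∈ χ c (φ a) (φ b)
  φ-edge _ _ (out j) = lookup⇒[]= i _ (i∈χvψ j)
  φ-edge _ _ (inn j) = lookup⇒[]= i _ $
    subst (λ p → lookup p i ≡ true) (symmetric c v (ψ j) (ψ≢v j ∘ sym)) (i∈χvψ j)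

degree⇒star : ∀ {N r s} (c : SetColouring N r s) v i {n} → n ≤ degree (χ c) v i → MonoCopy c i (K1 n)
degree⇒star c v i n≤deg =
  let ψ , ψ-injective , ψ-neighbour = ≤count⇒injection (neighbour? (χ c) v i) n≤deg
  in  neighbours⇒star c v i ψ ψ-injective ψ-neighbour

star⇒degree : ∀ {N r s} (c : SetColouring N r s) i {n} → (copy : MonoCopy c i (K1 n)) →
  n ≤ degree (χ c) (proj₁ copy zero) i
star⇒degree c i (φ , φ-injective , φ-edge) =
  injection⇒≤count (neighbour? (χ c) (φ zero) i) (φ ∘ suc) (Fin.suc-injective ∘ φ-injective) λ j →
    trans (neighbour?-≢ (χ c) i (λ e → Fin.0≢1+n (φ-injective (sym e))))
          ([]=⇒lookup (φ-edge zero (suc j) (out j)))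

∑-degree : ∀ {N r s} (c : SetColouring (suc N) r s) v → ∑[ i < r ] degree (χ c) v i ≡ N * s
∑-degree {N} {r} {s} c v = begin
  ∑[ i < r ] ∑[ u < suc N ] bit (neighbour? (χ c) v i u)
    ≡⟨ ∑-comm (λ i u → bit (neighbour? (χ c) v i u)) ⟩
  ∑[ u < suc N ] count (λ i → neighbour? (χ c) v i u)
    ≡⟨ sum-remove {i = v} (λ u → count (λ i → neighbour? (χ c) v i u)) ⟩
  count (λ i → neighbour? (χ c) v i v) + ∑[ u < N ] count (λ i → neighbour? (χ c) v i (punchIn v u))
    ≡⟨ cong₂ _+_ (trans (count-cong (neighbour?-self (χ c) v)) (sum-replicate-zero r))
                 (sum-cong-≗ {N} (λ u → edge-size (Fin.punchInᵢ≢i v u))) ⟩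
  ∑[ u < N ] s
    ≡⟨ ∑-const N s ⟩
  N * s
    ∎
  where
  open ≡-Reasoning
  edge-size : ∀ {u} → u ≢ v → count (λ i → neighbour? (χ c) v i u) ≡ s
  edge-size {u} u≢v = begin
    count (λ i → neighbour? (χ c) v i u) ≡⟨ count-cong (λ i → neighbour?-≢ (χ c) i u≢v) ⟩
    count (lookup (χ c v u))             ≡⟨ sym (∣p∣≡count-lookup (χ c v u)) ⟩
    ∣ χ c v u ∣                           ≡⟨ size c v u (u≢v ∘ sym) ⟩
    s                                    ∎

-- The upper bound

ramsey-suc : ∀ r s (n : Fin r → ℕ) U → Σn n ∸ r + 1 ≤ U * s → RamseyProp r s (stars n) (suc U)
ramsey-suc r s n U Σn∸r<Us c with Fin.any? (λ i → n i ≤? degree (χ c) zero i)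
... | yes (i , nᵢ≤deg) = i , degree⇒star c zero i nᵢ≤deg
... | no  ¬big         = contradiction (∑-mono-< (degree (χ c) zero) n λ i → ≰⇒> (¬big ∘ (i ,_))) $
  <⇒≱ $ begin-strict
    ∑[ i < r ] n i                     ≡⟨ sym (Σn≡∑ n) ⟩
    Σn n                               ≤⟨ m≤n+m∸n (Σn n) r ⟩
    r + (Σn n ∸ r)                     <⟨ +-monoʳ-< r (m<m+n _ z<s) ⟩
    r + (Σn n ∸ r + 1)                 ≤⟨ +-monoʳ-≤ r Σn∸r<Us ⟩
    r + U * s                          ≡⟨ cong (r +_) (sym (∑-degree c zero)) ⟩
    r + ∑[ i < r ] degree (χ c) zero i ∎
  where open ≤-Reasoning

ramsey-upperExpr : ∀ r s (n : Fin r → ℕ) .{{_ : NonZero s}} → RamseyProp r s (stars n) (upperExpr r s n + 1)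
ramsey-upperExpr r s n = subst (RamseyProp r s (stars n)) (+-comm 1 (upperExpr r s n))
  (ramsey-suc r s n (upperExpr r s n) (m≤⌈m/n⌉*n (Σn n ∸ r + 1) s))

-- Deciding the Ramsey property by exhaustive search

Exhaustible : Set → Set₁
Exhaustible A = ∀ {P : Pred A 0ℓ} → Decidable P → Dec (∃ P)

Vec-exhaustible : ∀ {A} → Exhaustible A → ∀ n → Exhaustible (Vec A n)
Vec-exhaustible exA zero    P? = map′ ([] ,_) (λ { ([] , p) → p }) (P? [])
Vec-exhaustible exA (suc n) P? =
  map′ (λ (a , w , p) → a ∷ w , p) (λ { (a ∷ w , p) → a , w , p })
       (exA λ a → Vec-exhaustible exA n (P? ∘ (a ∷_)))

module _ (r s : ℕ) (n : Fin r → ℕ) where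

  Avoiding : ℕ → Set
  Avoiding M = Σ (SetColouring M r s) λ c → ∀ v i → degree (χ c) v i < n i

  avoiding⇒¬ramsey : ∀ {M} → Avoiding M → ¬ RamseyProp r s (stars n) M
  avoiding⇒¬ramsey (c , deg<n) ramsey =
    let i , copy = ramsey c in <⇒≱ (deg<n (proj₁ copy zero) i) (star⇒degree c i copy)

  ¬avoiding⇒ramsey : ∀ {M} → ¬ Avoiding M → RamseyProp r s (stars n) M
  ¬avoiding⇒ramsey ¬avoiding c with Fin.any? (λ v → Fin.any? (λ i → n i ≤? degree (χ c) v i))
  ... | yes (v , i , big) = i , degree⇒star c v i big
  ... | no  ¬big          = contradiction (c , λ v i → ≰⇒> (¬big ∘ λ big → v , i , big)) ¬avoiding

  IsAvoiding : ∀ {M} → (Fin M → Fin M → Subset r) → Set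
  IsAvoiding χ = (∀ u v → u ≢ v → χ u v ≡ χ v u)
               × (∀ u v → u ≢ v → ∣ χ u v ∣ ≡ s)
               × (∀ v i → degree χ v i < n i)

  isAvoiding? : ∀ {M} (χ : Fin M → Fin M → Subset r) → Dec (IsAvoiding χ)
  isAvoiding? χ =
    Fin.all? (λ u → Fin.all? λ v → ¬? (u Fin.≟ v) →-dec ≡-dec Bool._≟_ (χ u v) (χ v u))
    ×-dec Fin.all? (λ u → Fin.all? λ v → ¬? (u Fin.≟ v) →-dec ∣ χ u v ∣ ≟ s)
    ×-dec Fin.all? (λ v → Fin.all? λ i → degree χ v i <? n i)

  isAvoiding-cong : ∀ {M} {χ χ′ : Fin M → Fin M → Subset r} → (∀ u v → χ u v ≡ χ′ u v) →
    IsAvoiding χ → IsAvoiding χ′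
  isAvoiding-cong χ≡χ′ (sym-χ , size-χ , deg-χ) =
    (λ u v u≢v → trans (sym (χ≡χ′ u v)) (trans (sym-χ u v u≢v) (χ≡χ′ v u))) ,
    (λ u v u≢v → trans (cong ∣_∣ (sym (χ≡χ′ u v))) (size-χ u v u≢v)) ,
    (λ v i → subst (_< n i) (degree-cong χ≡χ′ v i) (deg-χ v i))

  avoiding? : ∀ M → Dec (Avoiding M)
  avoiding? M = map′ fromTable toTable
    (Vec-exhaustible (Vec-exhaustible anySubset? M) M (isAvoiding? ∘ entry))
    where
    entry : Vec (Vec (Subset r) M) M → Fin M → Fin M → Subset r
    entry table u v = lookup (lookup table u) v
    fromTable : ∃ (IsAvoiding ∘ entry) → Avoiding M
    fromTable (table , sym-table , size-table , deg-table) =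
      record { χ = entry table ; symmetric = sym-table ; size = size-table } , deg-table
    toTable : Avoiding M → ∃ (IsAvoiding ∘ entry)
    toTable (c , deg<n) = table , isAvoiding-cong entry-table (symmetric c , size c , deg<n)
      where
      table : Vec (Vec (Subset r) M) M
      table = tabulate λ u → tabulate λ v → χ c u v
      entry-table : ∀ u v → χ c u v ≡ entry table u v
      entry-table u v = sym (trans (cong (λ row → lookup row v) (lookup∘tabulate _ u)) (lookup∘tabulate _ v))

  ramsey? : ∀ M → Dec (RamseyProp r s (stars n) M)
  ramsey? M with avoiding? M
  ... | yes avoiding = no  (avoiding⇒¬ramsey avoiding)
  ... | no ¬avoiding = yes (¬avoiding⇒ramsey ¬avoiding)

-- The cyclic colouring

module Cyclic (r′ s M′ : ℕ) .{{_ : NonZero s}} where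

  private
    r M : ℕ
    r = suc r′
    M = suc M′

  position : Fin M → Fin M → ℕ
  position u v = (toℕ u + toℕ v) % M

  position-injective : ∀ v {u u′} → position v u ≡ position v u′ → u ≡ u′
  position-injective v {u} {u′} eq = Fin.toℕ-injective (begin
    toℕ u                                 ≡⟨ recover u ⟨
    (position v u + M′ * toℕ v) % M       ≡⟨ cong (λ p → (p + M′ * toℕ v) % M) eq ⟩
    (position v u′ + M′ * toℕ v) % M      ≡⟨ recover u′ ⟩
    toℕ u′                                ∎)
    where
    open ≡-Reasoning
    recover : ∀ u → (position v u + M′ * toℕ v) % M ≡ toℕ u
    recover u = begin
      (position v u + M′ * toℕ v) % M     ≡⟨ [m%n+k]%n≡[m+k]%n (toℕ v + toℕ u) (M′ * toℕ v) M ⟩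
      (toℕ v + toℕ u + M′ * toℕ v) % M    ≡⟨ cong (_% M) (y+x+n*y≡x+y*[1+n] (toℕ u) (toℕ v) M′) ⟩
      (toℕ u + toℕ v * M) % M             ≡⟨ [m+kn]%n≡m%n (toℕ u) (toℕ v) M ⟩
      toℕ u % M                           ≡⟨ m<n⇒m%n≡m (Fin.toℕ<n u) ⟩
      toℕ u                               ∎
      where
      y+x+n*y≡x+y*[1+n] : ∀ x y n → y + x + n * y ≡ x + y * suc n
      y+x+n*y≡x+y*[1+n] = solve-∀

  -- Colour c lies in block p iff its offset from p s is below s; r′ · p s ≡ − p s (mod r).
  offset : ℕ → Fin r → ℕ
  offset p c = (toℕ c + r′ * (p * s)) % r

  block : ℕ → Subset r
  block p = tabulate λ c → offset p c <ᵇ s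

  ∣block∣≡s : s ≤ r → ∀ p → ∣ block p ∣ ≡ s
  ∣block∣≡s s≤r p = begin
    ∣ block p ∣                          ≡⟨ ∣tabulate∣≡count (λ c → offset p c <ᵇ s) ⟩
    count {r} (λ c → offset p c <ᵇ s)   ≡⟨ count-rotate r (_<ᵇ s) (r′ * (p * s)) ⟩
    count {r} (λ c → toℕ c <ᵇ s)        ≡⟨ count-<ᵇ r s s≤r ⟩
    s                                 ∎
    where open ≡-Reasoning

  ∈block⇒offset<s : ∀ {p c} → lookup (block p) c ≡ true → offset p c < s
  ∈block⇒offset<s {p} {c} c∈block =
    <ᵇ⇒< (offset p c) s (Equivalence.from Bool.T-≡ (trans (sym (lookup∘tabulate (λ c → offset p c <ᵇ s) c)) c∈block))

  colouring : s ≤ r → SetColouring M r s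
  colouring s≤r = record
    { χ         = λ u v → block (position u v)
    ; symmetric = λ u v _ → cong (λ x → block (x % M)) (+-comm (toℕ u) (toℕ v))
    ; size      = λ u v _ → ∣block∣≡s s≤r (position u v)
    }

  slot : ℕ → Fin r → ℕ
  slot p c = offset p c + p * s

  slot%r : ∀ p c → slot p c % r ≡ toℕ c
  slot%r p c = begin
    ((toℕ c + r′ * (p * s)) % r + p * s) % r   ≡⟨ [m%n+k]%n≡[m+k]%n (toℕ c + r′ * (p * s)) (p * s) r ⟩
    (toℕ c + r′ * (p * s) + p * s) % r         ≡⟨ cong (_% r) (x+n*y+y≡x+y*[1+n] (toℕ c) (p * s) r′) ⟩
    (toℕ c + p * s * r) % r                    ≡⟨ [m+kn]%n≡m%n (toℕ c) (p * s) r ⟩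
    toℕ c % r                                  ≡⟨ m<n⇒m%n≡m (Fin.toℕ<n c) ⟩
    toℕ c                                      ∎
    where
    open ≡-Reasoning
    x+n*y+y≡x+y*[1+n] : ∀ x y n → x + n * y + y ≡ x + y * suc n
    x+n*y+y≡x+y*[1+n] = solve-∀

  slot/s : ∀ p c → offset p c < s → slot p c / s ≡ p
  slot/s p c offset<s = begin
    (offset p c + p * s) / s         ≡⟨ +-distrib-/-∣ʳ (offset p c) (divides-refl p) ⟩
    offset p c / s + p * s / s       ≡⟨ cong₂ _+_ (m<n⇒m/n≡0 offset<s) (m*n/n≡m p s) ⟩
    p                                ∎
    where open ≡-Reasoning

  slot< : ∀ p c → p < M → offset p c < s → slot p c < M * s
  slot< p c p<M offset<s = begin-strict
    offset p c + p * s  <⟨ +-monoˡ-< (p * s) offset<s ⟩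
    suc p * s           ≤⟨ *-monoˡ-≤ s p<M ⟩
    M * s               ∎
    where open ≤-Reasoning

  -- An i-neighbour u of v yields the slot of i in block (position v u), which determines u;
  -- as it is ≡ i (mod r) and below M s ≤ r m, its quotient by r is below m.
  degree≤ : (s≤r : s ≤ r) {m : ℕ} → M * s ≤ r * m → ∀ v i → degree (χ (colouring s≤r)) v i ≤ m
  degree≤ s≤r {m} Ms≤rm v i = count≤ (neighbour? (χ (colouring s≤r)) v i) quotient quotient-injective
    where
    neighbour⇒offset<s : ∀ {u} → neighbour? (χ (colouring s≤r)) v i u ≡ true → offset (position v u) i < s
    neighbour⇒offset<s {u} nb =
      ∈block⇒offset<s {position v u} {i} (proj₂ (neighbour?-true (χ (colouring s≤r)) {v} {u} i nb))
    quotient< : ∀ {u} → neighbour? (χ (colouring s≤r)) v i u ≡ true → slot (position v u) i / r < m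
    quotient< {u} nb = m<n*o⇒m/o<n (begin-strict
      slot (position v u) i   <⟨ slot< (position v u) i (m%n<n (toℕ v + toℕ u) M) (neighbour⇒offset<s nb) ⟩
      M * s                   ≤⟨ Ms≤rm ⟩
      r * m                   ≡⟨ *-comm r m ⟩
      m * r                   ∎)
      where open ≤-Reasoning
    quotient : ∀ u → neighbour? (χ (colouring s≤r)) v i u ≡ true → Fin m
    quotient u nb = fromℕ< (quotient< nb)
    slot≡ : ∀ p → slot p i ≡ toℕ i + slot p i / r * r
    slot≡ p = trans (m≡m%n+[m/n]*n (slot p i) r) (cong (_+ slot p i / r * r) (slot%r p i))
    quotient-injective : ∀ {u u′} nb nb′ → quotient u nb ≡ quotient u′ nb′ → u ≡ u′
    quotient-injective {u} {u′} nb nb′ eq = position-injective v (begin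
      position v u                  ≡⟨ slot/s (position v u) i (neighbour⇒offset<s nb) ⟨
      slot (position v u) i / s     ≡⟨ cong (_/ s) same-slot ⟩
      slot (position v u′) i / s    ≡⟨ slot/s (position v u′) i (neighbour⇒offset<s nb′) ⟩
      position v u′                 ∎)
      where
      open ≡-Reasoning
      same-quotient : slot (position v u) i / r ≡ slot (position v u′) i / r
      same-quotient = trans (sym (Fin.toℕ-fromℕ< (quotient< nb))) (trans (cong toℕ eq) (Fin.toℕ-fromℕ< (quotient< nb′)))
      same-slot : slot (position v u) i ≡ slot (position v u′) i
      same-slot = trans (slot≡ (position v u)) (trans (cong (λ q → toℕ i + q * r) same-quotient) (sym (slot≡ (position v u′))))

avoiding-below : ∀ {r s} .{{_ : NonZero s}} (n : Fin r → ℕ) m M → 0 < r → s ≤ r →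
  (∀ i → m < n i) → M * s ≤ r * m → Avoiding r s n M
avoiding-below n m zero _ _ _ _ = record { χ = λ () ; symmetric = λ () ; size = λ () } , λ ()
avoiding-below {suc r′} {s} n m (suc M′) _ s≤r m<n Ms≤rm =
  Cyclic.colouring r′ s M′ s≤r , λ v i → ≤-<-trans (Cyclic.degree≤ r′ s M′ s≤r Ms≤rm v i) (m<n i)

∃-least : {P : Pred ℕ 0ℓ} → Decidable P → ∀ {N} → P N →
  ∃ λ R → R ≤ N × P R × (∀ M → M < R → ¬ P M)
∃-least {P} P? = <-rec _ least _
  where
  least : ∀ N → (∀ {M} → M < N → P M → ∃ λ R → R ≤ M × P R × (∀ M → M < R → ¬ P M)) →
    P N → ∃ λ R → R ≤ N × P R × (∀ M → M < R → ¬ P M)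
  least N rec pN with anyUpTo? P? N
  ... | yes (M , M<N , pM) = let R , R≤M , pR , below = rec M<N pM in R , ≤-trans R≤M (<⇒≤ M<N) , pR , below
  ... | no  ¬below         = N , ≤-refl , pN , λ M M<N pM → ¬below (M , M<N , pM)

¬ramsey≤lowerExpr : ∀ r s (n : Fin r → ℕ) (0<r : 0 < r) .{{_ : NonZero s}} → Hyp r s n 0<r →
  ∀ M → M ≤ lowerExpr r s n 0<r → ¬ RamseyProp r s (stars n) M
¬ramsey≤lowerExpr r s n 0<r (_ , s<r , 3≤n₁ , n-mono) M M≤L = avoiding⇒¬ramsey r s n $
  avoiding-below n (n₁ ∸ 1) M 0<r (<⇒≤ s<r) n₁∸1<n $ begin
    M * s                        ≤⟨ *-monoˡ-≤ s M≤L ⟩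
    lowerExpr r s n 0<r * s      ≤⟨ m/n*n≤m (r * n₁ ∸ r) s ⟩
    r * n₁ ∸ r                   ≡⟨ cong (r * n₁ ∸_) (*-identityʳ r) ⟨
    r * n₁ ∸ r * 1               ≡⟨ *-distribˡ-∸ r n₁ 1 ⟨
    r * (n₁ ∸ 1)                 ∎
  where
  open ≤-Reasoning
  n₁ : ℕ
  n₁ = n (fromℕ< 0<r)
  n₁∸1<n : ∀ i → n₁ ∸ 1 < n i
  n₁∸1<n i = <-≤-trans (∸-monoʳ-< z<s (≤-trans (s≤s z≤n) 3≤n₁))
                       (n-mono (fromℕ< 0<r) i (subst (_≤ toℕ i) (sym (Fin.toℕ-fromℕ< 0<r)) z≤n))

ramsey-bounds : (r s : ℕ) → (n : Fin r → ℕ) → (0<r : 0 < r) → .{{_ : NonZero s}} →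
  FullHyp r s n 0<r →
  ∃ λ R → IsSetColouringRamsey r s (stars n) R
    × lowerExpr r s n 0<r + 1 ≤ R
    × R ≤ upperExpr r s n + 1
ramsey-bounds r s n 0<r (hyp , _) =
  let R , R≤U+1 , ramseyR , below = ∃-least (ramsey? r s n) (ramsey-upperExpr r s n)
      L<R = ≰⇒> λ R≤L → ¬ramsey≤lowerExpr r s n 0<r hyp R R≤L ramseyR
  in  R , (ramseyR , below) , subst (_≤ R) (+-comm 1 _) L<R , R≤U+1

-- Sharpness

-- matching u v indexes the perfect matching of K₄ containing the edge uv, which gets the
-- other two colours; each colour class is then a union of two perfect matchings.
matching : Fin 4 → Fin 4 → Fin 3
matching 0F 1F = 0F
matching 1F 0F = 0F
matching 2F 3F = 0F
matching 3F 2F = 0F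
matching 0F 2F = 1F
matching 2F 0F = 1F
matching 1F 3F = 1F
matching 3F 1F = 1F
matching _  _  = 2F

K₄-avoiding : Avoiding 3 2 (λ _ → 3) 4
K₄-avoiding = colouring , degree<3
  where
  χ₄ : Fin 4 → Fin 4 → Subset 3
  χ₄ u v = ∁ ⁅ matching u v ⁆
  matching-sym : ∀ u v → matching u v ≡ matching v u
  matching-sym = toWitness {a? = Fin.all? λ u → Fin.all? λ v → matching u v Fin.≟ matching v u} tt
  colouring : SetColouring 4 3 2
  colouring = record
    { χ         = χ₄
    ; symmetric = λ u v _ → cong (∁ ∘ ⁅_⁆) (matching-sym u v)
    ; size      = λ u v _ → trans (∣∁p∣≡n∸∣p∣ ⁅ matching u v ⁆) (cong (3 ∸_) (∣⁅x⁆∣≡1 (matching u v)))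
    }
  degree<3 : ∀ v i → degree χ₄ v i < 3
  degree<3 = toWitness {a? = Fin.all? λ v → Fin.all? λ i → degree χ₄ v i <? 3} tt

hyp-K₁,₃ : FullHyp 3 2 (λ _ → 3) (s≤s z≤n)
hyp-K₁,₃ = (s≤s z≤n , ≤-refl , ≤-refl , λ _ _ _ → ≤-refl) , ≤-refl

R₃,₂[K₁,₃]≡5 : IsSetColouringRamsey 3 2 (stars (λ _ → 3)) 5
R₃,₂[K₁,₃]≡5 = pin (ramsey-bounds 3 2 (λ _ → 3) (s≤s z≤n) hyp-K₁,₃)
  where
  pin : (∃ λ R → IsSetColouringRamsey 3 2 (stars (λ _ → 3)) R × 4 ≤ R × R ≤ 5) →
    IsSetColouringRamsey 3 2 (stars (λ _ → 3)) 5
  pin (R , isR , 4≤R , R≤5) =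
    subst (IsSetColouringRamsey 3 2 (stars (λ _ → 3))) (≤-antisym R≤5 (≤∧≢⇒< 4≤R 4≢R)) isR
    where
    4≢R : 4 ≢ R
    4≢R refl = avoiding⇒¬ramsey 3 2 (λ _ → 3) K₄-avoiding (proj₁ isR)

theorem2p9 : ((r s : ℕ) → (n : Fin r → ℕ) → (0<r : 0 < r) → .{{nz : NonZero s}} →
                 FullHyp r s n 0<r →
                 ∃ λ R → IsSetColouringRamsey r s (λ i → K1 (n i)) R
                   × lowerExpr r s n 0<r + 1 ≤ R
                   × R ≤ upperExpr r s n + 1)
             × (∃ λ r → ∃ λ s → Σ (Fin r → ℕ) λ n → Σ (0 < r) λ 0<r → Σ (NonZero s) λ nz →
                 FullHyp r s n 0<r {{nz}}
                 × IsSetColouringRamsey r s (λ i → K1 (n i)) (upperExpr r s n {{nz}} + 1))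
theorem2p9 = ramsey-bounds , (3 , 2 , (λ _ → 3) , s≤s z≤n , _ , hyp-K₁,₃ , R₃,₂[K₁,₃]≡5)
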